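{- Let $d\ge 2$. For all $n\in\mathbb{N}$ and every $j\in\{1,\ldots,d\}$, $$r_j(n)\equiv r_j(n+2^{d-j})\pmod{2^d-1}.$$ Moreover, for all $n\in\mathbb{N}$ and all $j\in\{1,\ldots,d\}$, $r_j(n)\equiv r_j(n+2^{d-1})\pmod{2^{j-1}(2^d-1)}$.
   Context: $\mathbb{N}=\{1,2,\ldots\}$. For $n\in\mathbb{N}$ and $i\in\{1,\ldots,d\}$, $r_i(n)=\left\lfloor \frac{(2^d-1)n}{2^{d-i}}\right\rfloor-2^{i-1}+1$. (The paper writes the second statement as $\mathbf{r}(n)\equiv\mathbf{r}(n+2^{d-1}) \pmod{2^d-1}_2$, where for a vector $\mathbf{x}$ the notation $\mathbf{x}\pmod{m}_2$ means the vector $(x_1 \bmod m, x_2\bmod 2m,\ldots,x_d\bmod 2^{d-1}m)$.) -}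

module Defs where

open import Data.Nat as ℕ using (ℕ; _∸_; _^_)
open import Data.Nat.DivMod using (_/_)
open import Data.Nat.Properties using (m^n≢0)
open import Data.Integer as ℤ using (ℤ; +_)
open import Data.Integer.Divisibility using (_∣_)

r : ℕ → ℕ → ℕ → ℤ
r d i n = ((+ (_/_ ((2 ^ d ∸ 1) ℕ.* n) (2 ^ (d ∸ i)) ⦃ m^n≢0 2 (d ∸ i) ⦄)) ℤ.- (+ (2 ^ (i ∸ 1)))) ℤ.+ (+ 1)

_≡_[mod_] : ℤ → ℤ → ℕ → Set
a ≡ b [mod m ] = (+ m) ∣ (a ℤ.- b)

-- Write M = 2^d - 1.  If M m = c 2^(d-j), then shifting n by m adds to M n a multiple
-- of the divisor 2^(d-j), which passes through the floor: ⌊M (n + m) / 2^(d-j)⌋ is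
-- ⌊M n / 2^(d-j)⌋ + c, so r_j(n + m) = r_j(n) + c.  For m = 2^(d-j) take
-- c = M; for m = 2^(d-1) = 2^(j-1) 2^(d-j) take c = 2^(j-1) M.
module Submission where

open import Defs
open import Data.Nat using (ℕ; _≤_; _*_; _^_; _∸_; _+_; suc; NonZero)
open import Data.Product using (_×_; _,_)
open import Data.Nat.DivMod using (_/_; +-distrib-/-∣ʳ; m*n/n≡m)
open import Data.Nat.Divisibility using (_∣_; ∣-refl; divides-refl)
open import Data.Nat.Properties
  using (m^n≢0; ^-distribˡ-+-*; m+[n∸m]≡n; *-distribˡ-+; *-assoc; *-comm)
open import Data.Integer as ℤ using (ℤ; +_; ∣_∣)
open import Data.Integer.Properties using (pos-+; ∣-i∣≡∣i∣)
open import Data.Integer.Tactic.RingSolver using (solve-∀)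
open import Relation.Binary.PropositionalEquality
  using (_≡_; refl; sym; cong; subst; module ≡-Reasoning)

[m+kn]/n≡m/n+k : ∀ m k n .{{_ : NonZero n}} → (m + k * n) / n ≡ m / n + k
[m+kn]/n≡m/n+k m k n = begin
  (m + k * n) / n   ≡⟨ +-distrib-/-∣ʳ m (divides-refl k) ⟩
  m / n + k * n / n ≡⟨ cong (λ t → m / n + t) (m*n/n≡m k n) ⟩
  m / n + k         ∎
  where open ≡-Reasoning

i≡i+m[mod-m] : ∀ (i : ℤ) (m : ℕ) → i ≡ i ℤ.+ + m [mod m ]
-- Defs uses the unsigned divisibility of Data.Integer.Divisibility: m ∣ ∣ x ∣ in ℕ.
i≡i+m[mod-m] i m = subst (m ∣_) (sym ∣i-[i+m]∣≡m) ∣-refl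
  where
  i-[i+j]≡-j : ∀ (i j : ℤ) → i ℤ.- (i ℤ.+ j) ≡ ℤ.- j
  i-[i+j]≡-j = solve-∀
  ∣i-[i+m]∣≡m : ∣ i ℤ.- (i ℤ.+ + m) ∣ ≡ m
  ∣i-[i+m]∣≡m = begin
    ∣ i ℤ.- (i ℤ.+ + m) ∣ ≡⟨ cong ∣_∣ (i-[i+j]≡-j i (+ m)) ⟩
    ∣ ℤ.- (+ m) ∣         ≡⟨ ∣-i∣≡∣i∣ (+ m) ⟩
    m                     ∎
    where open ≡-Reasoning

r-shift : ∀ d j n m c → (2 ^ d ∸ 1) * m ≡ c * 2 ^ (d ∸ j) →
          r d j (n + m) ≡ r d j n ℤ.+ + c
r-shift d j n m c Mm≡c2ᵏ = begin
  (+ (M * (n + m) / 2ᵏ) ℤ.- p) ℤ.+ + 1   ≡⟨ cong (λ q → (+ q ℤ.- p) ℤ.+ + 1) quotient-shift ⟩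
  (+ (a + c) ℤ.- p) ℤ.+ + 1              ≡⟨ cong (λ x → (x ℤ.- p) ℤ.+ + 1) (pos-+ a c) ⟩
  ((+ a ℤ.+ + c) ℤ.- p) ℤ.+ + 1          ≡⟨ move-+c (+ a) (+ c) p ⟩
  ((+ a ℤ.- p) ℤ.+ + 1) ℤ.+ + c          ∎
  where
  open ≡-Reasoning
  M 2ᵏ a : ℕ
  M = 2 ^ d ∸ 1
  2ᵏ = 2 ^ (d ∸ j)
  p : ℤ
  p = + (2 ^ (j ∸ 1))
  instance 2ᵏ≢0 : NonZero 2ᵏ
  2ᵏ≢0 = m^n≢0 2 (d ∸ j)
  a = M * n / 2ᵏ
  quotient-shift : M * (n + m) / 2ᵏ ≡ a + c
  quotient-shift = begin
    M * (n + m) / 2ᵏ     ≡⟨ cong (_/ 2ᵏ) (*-distribˡ-+ M n m) ⟩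
    (M * n + M * m) / 2ᵏ ≡⟨ cong (λ t → (M * n + t) / 2ᵏ) Mm≡c2ᵏ ⟩
    (M * n + c * 2ᵏ) / 2ᵏ ≡⟨ [m+kn]/n≡m/n+k (M * n) c 2ᵏ ⟩
    a + c                ∎
  move-+c : ∀ (x y z : ℤ) → ((x ℤ.+ y) ℤ.- z) ℤ.+ + 1 ≡ ((x ℤ.- z) ℤ.+ + 1) ℤ.+ y
  move-+c = solve-∀

r-shift-mod : ∀ d j n m c → (2 ^ d ∸ 1) * m ≡ c * 2 ^ (d ∸ j) →
              r d j n ≡ r d j (n + m) [mod c ]
r-shift-mod d j n m c eq = subst (λ x → r d j n ≡ x [mod c ]) (sym (r-shift d j n m c eq))
                                 (i≡i+m[mod-m] (r d j n) c)

2^[d∸1]≡2^[j∸1]*2^[d∸j] : ∀ d j → 1 ≤ j → j ≤ d → 2 ^ (d ∸ 1) ≡ 2 ^ (j ∸ 1) * 2 ^ (d ∸ j)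
2^[d∸1]≡2^[j∸1]*2^[d∸j] d (suc j) _ j<d = begin
  2 ^ (d ∸ 1)                 ≡⟨ cong (λ e → 2 ^ (e ∸ 1)) (sym (m+[n∸m]≡n j<d)) ⟩
  2 ^ (j + (d ∸ suc j))       ≡⟨ ^-distribˡ-+-* 2 j (d ∸ suc j) ⟩
  2 ^ j * 2 ^ (d ∸ suc j)     ∎
  where open ≡-Reasoning

lemma5 : (d : ℕ) → 2 ≤ d →
    ((n j : ℕ) → 1 ≤ n → 1 ≤ j → j ≤ d →
      r d j n ≡ r d j (n + 2 ^ (d ∸ j)) [mod (2 ^ d ∸ 1) ])
    × ((n j : ℕ) → 1 ≤ n → 1 ≤ j → j ≤ d →
      r d j n ≡ r d j (n + 2 ^ (d ∸ 1)) [mod 2 ^ (j ∸ 1) * (2 ^ d ∸ 1) ])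
lemma5 d _ = (λ n j _ _ _ → r-shift-mod d j n (2 ^ (d ∸ j)) M refl)
           , (λ n j _ 1≤j j≤d → r-shift-mod d j n (2 ^ (d ∸ 1)) (2 ^ (j ∸ 1) * M) (M·2^[d∸1] j 1≤j j≤d))
  where
  open ≡-Reasoning
  M : ℕ
  M = 2 ^ d ∸ 1
  M·2^[d∸1] : ∀ j → 1 ≤ j → j ≤ d → M * 2 ^ (d ∸ 1) ≡ 2 ^ (j ∸ 1) * M * 2 ^ (d ∸ j)
  M·2^[d∸1] j 1≤j j≤d = begin
    M * 2 ^ (d ∸ 1)                   ≡⟨ cong (M *_) (2^[d∸1]≡2^[j∸1]*2^[d∸j] d j 1≤j j≤d) ⟩
    M * (2 ^ (j ∸ 1) * 2 ^ (d ∸ j))   ≡⟨ sym (*-assoc M _ _) ⟩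
    M * 2 ^ (j ∸ 1) * 2 ^ (d ∸ j)     ≡⟨ cong (_* 2 ^ (d ∸ j)) (*-comm M (2 ^ (j ∸ 1))) ⟩
    2 ^ (j ∸ 1) * M * 2 ^ (d ∸ j)     ∎
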